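{- The term rewriting system $R_{fr}$ is convergent, i.e. it is terminating and confluent.
   Context: Fix a finite non-empty set $A$ of atomic propositions and an infinite set of variables. Terms are built from $T$, $F$, $a\in A$ and variables by the ternary operator $t\triangleleft r\triangleright s$. $R_{fr}$ is the term rewriting system with rules $x\triangleleft T\triangleright y\to x$; $x\triangleleft F\triangleright y\to y$; $T\triangleleft x\triangleright F\to x$; $x\triangleleft(y\triangleleft z\triangleright v)\triangleright w\to(x\triangleleft y\triangleright w)\triangleleft z\triangleright(x\triangleleft v\triangleright w)$, applied to instances of the left-hand sides in any subterm position. -}

module Defs where

open import Data.Nat using (ℕ)
open import Data.Product using (Σ; _×_; ∃)
open import Relation.Binary.Construct.Closure.ReflexiveTransitive using (Star)
open import Induction.WellFounded using (WellFounded)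

data Term (A : Set) : Set where
  T F     : Term A
  atom    : A → Term A
  var     : ℕ → Term A
  _◁_▷_   : Term A → Term A → Term A → Term A

infix 5 _◁_▷_

module _ {A : Set} where

  -- Root steps: all instances of the left-hand sides of R_fr.
  -- (All rules are left-linear, so an instance is obtained by replacing
  -- each rule variable by an arbitrary term.)
  data _⟶ᵣ_ : Term A → Term A → Set where
    r1 : ∀ x y → (x ◁ T ▷ y) ⟶ᵣ x
    r2 : ∀ x y → (x ◁ F ▷ y) ⟶ᵣ y
    r3 : ∀ x → (T ◁ x ▷ F) ⟶ᵣ x
    r4 : ∀ x y z v w →
         (x ◁ (y ◁ z ▷ v) ▷ w) ⟶ᵣ ((x ◁ y ▷ w) ◁ z ▷ (x ◁ v ▷ w))

  data _⟶_ : Term A → Term A → Set where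
    root : ∀ {s t} → s ⟶ᵣ t → s ⟶ t
    inˡ  : ∀ {t t'} r s → t ⟶ t' → (t ◁ r ▷ s) ⟶ (t' ◁ r ▷ s)
    inᵐ  : ∀ {r r'} t s → r ⟶ r' → (t ◁ r ▷ s) ⟶ (t ◁ r' ▷ s)
    inʳ  : ∀ {s s'} t r → s ⟶ s' → (t ◁ r ▷ s) ⟶ (t ◁ r ▷ s')

  _⟶*_ : Term A → Term A → Set
  _⟶*_ = Star _⟶_

  _⟵_ : Term A → Term A → Set
  s ⟵ t = t ⟶ s

Terminating : (A : Set) → Set
Terminating A = WellFounded (_⟵_ {A})

Confluent : (A : Set) → Set
Confluent A = ∀ (t u v : Term A) → t ⟶* u → t ⟶* v →
              ∃ λ w → (u ⟶* w) × (v ⟶* w)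

Convergent : (A : Set) → Set
Convergent A = Terminating A × Confluent A

-- R_fr terminates because the polynomial interpretation with all constants
-- and variables read as 2 and  x ◁ c ▷ w  read as  c (x + w + 1)  strictly
-- decreases along every rewrite step: the first three rules project onto a
-- proper subterm, and the distribution rule trades the factor
-- (y + v + 1)(x + w + 1) for  y(x + w + 1) + v(x + w + 1) + 1.  Every
-- critical pair of R_fr is joinable, so R_fr is locally confluent, and
-- Newman's lemma gives confluence.
module Submission where

open import Defs
open import Data.Nat using (ℕ; suc; _+_; _*_; _≤_; _<_; z<s; NonZero; >-nonZero; >-nonZero⁻¹)
open import Data.Nat.Properties
open import Data.Nat.Induction using (<-wellFounded)
open import Data.Fin using (Fin)
open import Data.Product using (∃; _×_; _,_)
open import Function using (flip)
open import Relation.Binary.PropositionalEquality using (_≡_; sym; cong; cong₂; module ≡-Reasoning)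
open import Relation.Binary.Construct.Closure.ReflexiveTransitive using (ε; _◅_; gmap)
open import Relation.Binary.Construct.Closure.Transitive using (Plus; [_]; _∼⁺⟨_⟩_)
open import Relation.Binary.Construct.On as On using ()
open import Relation.Binary.Rewriting using (WeaklyConfluent; sn&wcr⇒cr)
open import Induction.WellFounded using (WellFounded; module Subrelation)

⟦◁▷⟧ : ℕ → ℕ → ℕ → ℕ
⟦◁▷⟧ x c w = c * (x + w + 1)

1<x+w+1 : ∀ x w → .{{NonZero x}} → 1 < x + w + 1
1<x+w+1 x w = +-monoˡ-< 1 (≤-trans (>-nonZero⁻¹ x) (m≤m+n x w))

x+w+1-nonZero : ∀ x w → NonZero (x + w + 1)
x+w+1-nonZero x w = >-nonZero (m≤n+m 1 (x + w))

x+w<⟦◁▷⟧ : ∀ x c w → .{{NonZero c}} → x + w < ⟦◁▷⟧ x c w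
x+w<⟦◁▷⟧ x c w = <-≤-trans (m<m+n (x + w) z<s) (m≤n*m (x + w + 1) c)

⟦◁▷⟧-branchˡ< : ∀ x c w → .{{NonZero c}} → x < ⟦◁▷⟧ x c w
⟦◁▷⟧-branchˡ< x c w = ≤-<-trans (m≤m+n x w) (x+w<⟦◁▷⟧ x c w)

⟦◁▷⟧-branchʳ< : ∀ x c w → .{{NonZero c}} → w < ⟦◁▷⟧ x c w
⟦◁▷⟧-branchʳ< x c w = ≤-<-trans (m≤n+m w x) (x+w<⟦◁▷⟧ x c w)

⟦◁▷⟧-condition< : ∀ x c w → .{{NonZero x}} → .{{NonZero c}} → c < ⟦◁▷⟧ x c w
⟦◁▷⟧-condition< x c w = m<m*n c (x + w + 1) (1<x+w+1 x w)

⟦◁▷⟧-monoˡ-< : ∀ {x x'} c w → .{{NonZero c}} → x < x' → ⟦◁▷⟧ x c w < ⟦◁▷⟧ x' c w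
⟦◁▷⟧-monoˡ-< c w x<x' = *-monoʳ-< c (+-monoˡ-< 1 (+-monoˡ-< w x<x'))

⟦◁▷⟧-monoᵐ-< : ∀ {c c'} x w → c < c' → ⟦◁▷⟧ x c w < ⟦◁▷⟧ x c' w
⟦◁▷⟧-monoᵐ-< x w = *-monoˡ-< (x + w + 1) {{x+w+1-nonZero x w}}

⟦◁▷⟧-monoʳ-< : ∀ {w w'} x c → .{{NonZero c}} → w < w' → ⟦◁▷⟧ x c w < ⟦◁▷⟧ x c w'
⟦◁▷⟧-monoʳ-< x c w<w' = *-monoʳ-< c (+-monoˡ-< 1 (+-monoʳ-< x w<w'))

⟦◁▷⟧-distrib< : ∀ x y z v w → .{{NonZero x}} → .{{NonZero z}} →
                ⟦◁▷⟧ (⟦◁▷⟧ x y w) z (⟦◁▷⟧ x v w) < ⟦◁▷⟧ x (⟦◁▷⟧ y z v) w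
⟦◁▷⟧-distrib< x y z v w = begin-strict
  z * (y * K + v * K + 1)   <⟨ *-monoʳ-< z (+-monoʳ-< (y * K + v * K) (1<x+w+1 x w)) ⟩
  z * (y * K + v * K + K)   ≡⟨ cong (z *_) (sym (y+v+1-distrib y v)) ⟩
  z * ((y + v + 1) * K)     ≡⟨ *-assoc z (y + v + 1) K ⟨
  z * (y + v + 1) * K       ∎
  where
  open ≤-Reasoning
  K = x + w + 1
  y+v+1-distrib : ∀ y v → (y + v + 1) * K ≡ y * K + v * K + K
  y+v+1-distrib y v = begin-equality
    (y + v + 1) * K           ≡⟨ *-distribʳ-+ K (y + v) 1 ⟩
    (y + v) * K + 1 * K       ≡⟨ cong₂ _+_ (*-distribʳ-+ K y v) (*-identityˡ K) ⟩
    y * K + v * K + K         ∎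

module _ {A : Set} where

  weight : Term A → ℕ
  weight T           = 2
  weight F           = 2
  weight (atom _)    = 2
  weight (var _)     = 2
  weight (x ◁ c ▷ w) = ⟦◁▷⟧ (weight x) (weight c) (weight w)

  weight-nonZero : ∀ t → NonZero (weight t)
  weight-nonZero T           = _
  weight-nonZero F           = _
  weight-nonZero (atom _)    = _
  weight-nonZero (var _)     = _
  weight-nonZero (x ◁ c ▷ w) = m*n≢0 (weight c) (weight x + weight w + 1)
    {{weight-nonZero c}} {{x+w+1-nonZero (weight x) (weight w)}}

  ⟶ᵣ-decreases-weight : ∀ {s t} → s ⟶ᵣ t → weight t < weight s
  ⟶ᵣ-decreases-weight (r1 x y)       = ⟦◁▷⟧-branchˡ< (weight x) 2 (weight y)
  ⟶ᵣ-decreases-weight (r2 x y)       = ⟦◁▷⟧-branchʳ< (weight x) 2 (weight y)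
  ⟶ᵣ-decreases-weight (r3 x)         = ⟦◁▷⟧-condition< 2 (weight x) 2 {{_}} {{weight-nonZero x}}
  ⟶ᵣ-decreases-weight (r4 x y z v w) =
    ⟦◁▷⟧-distrib< (weight x) (weight y) (weight z) (weight v) (weight w)
      {{weight-nonZero x}} {{weight-nonZero z}}

  ⟶-decreases-weight : ∀ {s t} → s ⟶ t → weight t < weight s
  ⟶-decreases-weight (root p)    = ⟶ᵣ-decreases-weight p
  ⟶-decreases-weight (inˡ r s p) =
    ⟦◁▷⟧-monoˡ-< (weight r) (weight s) {{weight-nonZero r}} (⟶-decreases-weight p)
  ⟶-decreases-weight (inᵐ t s p) =
    ⟦◁▷⟧-monoᵐ-< (weight t) (weight s) (⟶-decreases-weight p)
  ⟶-decreases-weight (inʳ t r p) =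
    ⟦◁▷⟧-monoʳ-< (weight t) (weight r) {{weight-nonZero r}} (⟶-decreases-weight p)

  ⟶⁺-decreases-weight : ∀ {s t} → Plus _⟶_ s t → weight t < weight s
  ⟶⁺-decreases-weight [ p ]         = ⟶-decreases-weight p
  ⟶⁺-decreases-weight (_ ∼⁺⟨ p ⟩ q) = <-trans (⟶⁺-decreases-weight q) (⟶⁺-decreases-weight p)

  <-weight-wellFounded : WellFounded (λ (s t : Term A) → weight s < weight t)
  <-weight-wellFounded = On.wellFounded weight <-wellFounded

  terminating : Terminating A
  terminating = Subrelation.wellFounded ⟶-decreases-weight <-weight-wellFounded

  ⟶⁺-terminating : WellFounded (flip (Plus (_⟶_ {A})))
  ⟶⁺-terminating = Subrelation.wellFounded ⟶⁺-decreases-weight <-weight-wellFounded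

  Joinable : Term A → Term A → Set
  Joinable u v = ∃ λ w → (u ⟶* w) × (v ⟶* w)

  joinable-sym : ∀ {u v} → Joinable u v → Joinable v u
  joinable-sym (w , u⟶*w , v⟶*w) = w , v⟶*w , u⟶*w

  step : ∀ {s t : Term A} → s ⟶ t → s ⟶* t
  step p = p ◅ ε

  inˡ* : ∀ {t t' : Term A} r s → t ⟶* t' → (t ◁ r ▷ s) ⟶* (t' ◁ r ▷ s)
  inˡ* r s = gmap (λ t → t ◁ r ▷ s) (inˡ r s)

  inᵐ* : ∀ {r r' : Term A} t s → r ⟶* r' → (t ◁ r ▷ s) ⟶* (t ◁ r' ▷ s)
  inᵐ* t s = gmap (λ r → t ◁ r ▷ s) (inᵐ t s)

  inʳ* : ∀ {s s' : Term A} t r → s ⟶* s' → (t ◁ r ▷ s) ⟶* (t ◁ r ▷ s')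
  inʳ* t r = gmap (λ s → t ◁ r ▷ s) (inʳ t r)

  strip-T◁▷F-branches : ∀ (y z v : Term A) → ((T ◁ y ▷ F) ◁ z ▷ (T ◁ v ▷ F)) ⟶* (y ◁ z ▷ v)
  strip-T◁▷F-branches y z v = inˡ z _ (root (r3 y)) ◅ inʳ y z (root (r3 v)) ◅ ε

  root-peak-joinable : ∀ {t u v : Term A} → t ⟶ᵣ u → t ⟶ᵣ v → Joinable u v
  root-peak-joinable (r1 x y)          (r1 .x .y)           = x , ε , ε
  root-peak-joinable (r1 .T .F)        (r3 .T)              = T , ε , ε
  root-peak-joinable (r2 x y)          (r2 .x .y)           = y , ε , ε
  root-peak-joinable (r2 .T .F)        (r3 .F)              = F , ε , ε
  root-peak-joinable (r3 .T)           (r1 .T .F)           = T , ε , ε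
  root-peak-joinable (r3 .F)           (r2 .T .F)           = F , ε , ε
  root-peak-joinable (r3 x)            (r3 .x)              = x , ε , ε
  root-peak-joinable (r3 .(y ◁ z ▷ v)) (r4 .T y z v .F)     = _ , ε , strip-T◁▷F-branches y z v
  root-peak-joinable (r4 .T y z v .F)  (r3 .(y ◁ z ▷ v))    = _ , strip-T◁▷F-branches y z v , ε
  root-peak-joinable (r4 x y z v w)    (r4 .x .y .z .v .w)  = _ , ε , ε

  distribution-step-joinable : ∀ (x y z v w : Term A) {t} → (x ◁ (y ◁ z ▷ v) ▷ w) ⟶ t →
                               Joinable ((x ◁ y ▷ w) ◁ z ▷ (x ◁ v ▷ w)) t
  distribution-step-joinable x y z v w (root q) = root-peak-joinable (r4 x y z v w) q
  distribution-step-joinable x y z v w (inˡ _ .w q) =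
    _ , (inˡ z _ (inˡ y w q) ◅ inʳ _ z (inˡ v w q) ◅ ε) , step (root (r4 _ y z v w))
  distribution-step-joinable x y z v w (inʳ .x _ q) =
    _ , (inˡ z _ (inʳ x y q) ◅ inʳ _ z (inʳ x v q) ◅ ε) , step (root (r4 x y z v _))
  distribution-step-joinable x y z v w (inᵐ .x .w (inˡ .z .v q)) =
    _ , step (inˡ z _ (inᵐ x w q)) , step (root (r4 x _ z v w))
  distribution-step-joinable x y z v w (inᵐ .x .w (inᵐ .y .v q)) =
    _ , step (inᵐ _ _ q) , step (root (r4 x y _ v w))
  distribution-step-joinable x y z v w (inᵐ .x .w (inʳ .y .z q)) =
    _ , step (inʳ _ z (inᵐ x w q)) , step (root (r4 x y z _ w))
  distribution-step-joinable x y .T v w (inᵐ .x .w (root (r1 .y .v))) =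
    _ , step (root (r1 _ _)) , ε
  distribution-step-joinable x y .F v w (inᵐ .x .w (root (r2 .y .v))) =
    _ , step (root (r2 _ _)) , ε
  distribution-step-joinable x .T z .F w (inᵐ .x .w (root (r3 .z))) =
    _ , (inˡ z _ (root (r1 x w)) ◅ inʳ x z (root (r2 x w)) ◅ ε) , ε
  distribution-step-joinable x y .(z₁ ◁ z₂ ▷ z₃) v w (inᵐ .x .w (root (r4 .y z₁ z₂ z₃ .v))) =
    _ , step (root (r4 _ _ _ _ _)) ,
    (root (r4 x _ z₂ _ w) ◅ inˡ z₂ _ (root (r4 x y z₁ v w)) ◅ inʳ _ z₂ (root (r4 x y z₃ v w)) ◅ ε)

  root-step-joinable : ∀ {t u v : Term A} → t ⟶ᵣ u → t ⟶ v → Joinable u v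
  root-step-joinable p (root q) = root-peak-joinable p q
  root-step-joinable (r1 _ y) (inˡ .T .y q) = _ , step q , step (root (r1 _ y))
  root-step-joinable (r1 x y) (inᵐ .x .y (root ()))
  root-step-joinable (r1 x y) (inʳ .x .T q) = x , ε , step (root (r1 x _))
  root-step-joinable (r2 x y) (inˡ .F .y q) = y , ε , step (root (r2 _ y))
  root-step-joinable (r2 x y) (inᵐ .x .y (root ()))
  root-step-joinable (r2 x _) (inʳ .x .F q) = _ , step q , step (root (r2 x _))
  root-step-joinable (r3 x) (inˡ .x .F (root ()))
  root-step-joinable (r3 _) (inᵐ .T .F q) = _ , step q , step (root (r3 _))
  root-step-joinable (r3 x) (inʳ .T .x (root ()))
  root-step-joinable (r4 x y z v w) q = distribution-step-joinable x y z v w q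

  locally-confluent : WeaklyConfluent (_⟶_ {A})
  locally-confluent (root p) q = root-step-joinable p q
  locally-confluent p (root q) = joinable-sym (root-step-joinable q p)
  locally-confluent (inˡ r s p) (inˡ .r .s q) with locally-confluent p q
  ... | _ , p' , q' = _ , inˡ* r s p' , inˡ* r s q'
  locally-confluent (inᵐ t s p) (inᵐ .t .s q) with locally-confluent p q
  ... | _ , p' , q' = _ , inᵐ* t s p' , inᵐ* t s q'
  locally-confluent (inʳ t r p) (inʳ .t .r q) with locally-confluent p q
  ... | _ , p' , q' = _ , inʳ* t r p' , inʳ* t r q'
  locally-confluent (inˡ r s p) (inᵐ t .s q) = _ , step (inᵐ _ s q) , step (inˡ _ s p)
  locally-confluent (inˡ r s p) (inʳ t .r q) = _ , step (inʳ _ r q) , step (inˡ r _ p)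
  locally-confluent (inᵐ t s p) (inˡ r .s q) = _ , step (inˡ _ s q) , step (inᵐ _ s p)
  locally-confluent (inᵐ t s p) (inʳ .t r q) = _ , step (inʳ t _ q) , step (inᵐ t _ p)
  locally-confluent (inʳ t r p) (inˡ .r s q) = _ , step (inˡ r _ q) , step (inʳ _ r p)
  locally-confluent (inʳ t r p) (inᵐ .t s q) = _ , step (inᵐ t _ q) , step (inʳ t _ p)

  confluent : Confluent A
  confluent _ _ _ = sn&wcr⇒cr ⟶⁺-terminating locally-confluent

convergent : (A : Set) → Convergent A
convergent A = terminating , confluent

mainTheorem14 : (n : ℕ) → Convergent (Fin (suc n))
mainTheorem14 n = convergent (Fin (suc n))
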